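{- Let $n\ge 4$. For $s\in\{a,b\}$ and $j\ge 1$, let $s^n_j$ denote the number of orbits of size $j$ of the Basilica generator $s$ acting on $\{0,1\}^n$ (the "cycles of length $j$ labeled $s$" in the Schreier graph $\Sigma_n$). If $n$ is odd, then: - $a^n_{2^k}=2^{n-2k-1}$ for $1\le k\le \frac{n-1}{2}-1$, and $a^n_{2^k}=2$ for $k=\frac{n-1}{2}$; - $b^n_{2^k}=2^{n-2k}$ for $1\le k\le\frac{n-1}{2}-1$, $b^n_{2^k}=2$ for $k=\frac{n-1}{2}$, and $b^n_{2^k}=1$ for $k=\frac{n+1}{2}$. If $n$ is even, then: - $a^n_{2^k}=2^{n-2k-1}$ for $1\le k\le\frac n2-1$, and $a^n_{2^k}=1$ for $k=\frac n2$; - $b^n_{2^k}=2^{n-2k}$ for $1\le k\le \frac n2-1$, and $b^n_{2^k}=2$ for $k=\frac n2$.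
   Context: The Basilica group is generated by the maps $a,b$ acting on binary words, defined recursively for any binary word $w$ by - $a(0w)=0\,b(w)$ and $a(1w)=1w$; - $b(0w)=1\,a(w)$ and $b(1w)=0w$. Each of them restricts to a permutation of $\{0,1\}^n$ for every $n$. In the Schreier graph $\Sigma_n$, for each $s\in\{a,b\}$ and each $u\in\{0,1\}^n$ with $s(u)\ne u$, there is an edge labeled $s$ joining $u$ to $s(u)$. Thus each orbit of $s$ of size $j\ge2$ forms a cycle of length $j$ labeled $s$. -}

module Defs where

open import Data.Nat using (ℕ; zero; suc; _+_; _*_; _^_; _≤_; _≤?_)
open import Data.Nat using () renaming (_≟_ to _≟ℕ_)
open import Data.Bool using (Bool; true; false)
import Data.Bool as Bool
open import Data.Vec using (Vec; []; _∷_)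
import Data.Vec.Properties as VecP
open import Data.List using (List; []; _∷_; length; filter; map; _++_)
open import Data.Fin using (Fin; toℕ)
open import Data.Fin.Properties using (all?)
open import Data.Product using (_×_)
open import Relation.Binary.PropositionalEquality using (_≡_)
open import Relation.Nullary using (Dec; _×-dec_; _→-dec_)

-- Binary words of length n: letter 0 is `false`, letter 1 is `true`.
Word : ℕ → Set
Word n = Vec Bool n

mutual
  basA : ∀ {n} → Word n → Word n
  basA []          = []
  basA (false ∷ w) = false ∷ basB w
  basA (true  ∷ w) = true ∷ w

  basB : ∀ {n} → Word n → Word n
  basB []          = []
  basB (false ∷ w) = true ∷ basA w
  basB (true  ∷ w) = false ∷ w

data Gen : Set where
  genA genB : Gen

act : Gen → ∀ {n} → Word n → Word n
act genA = basA
act genB = basB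

iter : Gen → ∀ {n} → ℕ → Word n → Word n
iter s zero    u = u
iter s (suc k) u = act s (iter s k u)

allWords : (n : ℕ) → List (Word n)
allWords zero    = [] ∷ []
allWords (suc n) = map (false ∷_) (allWords n) ++ map (true ∷_) (allWords n)

-- A total order on words (lexicographic, first letter most significant),
-- used only to pick a canonical representative of each orbit.
value : ∀ {n} → Word n → ℕ
value []          = 0
value {suc n} (false ∷ w) = value w
value {suc n} (true  ∷ w) = 2 ^ n + value w

_≟w_ : ∀ {n} (u v : Word n) → Dec (u ≡ v)
_≟w_ = VecP.≡-dec Bool._≟_

IsOrbitRep : Gen → ∀ {n} → ℕ → Word n → Set
IsOrbitRep s zero    u = iter s 0 u ≡ u × (0 ≡ 1)   -- no orbit has size 0
IsOrbitRep s (suc j) u =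
  (iter s (suc j) u ≡ u)
  × ((i : Fin (suc j)) → iter s (suc (toℕ i)) u ≡ u → suc (toℕ i) ≡ suc j)
  × ((i : Fin (suc j)) → value u ≤ value (iter s (toℕ i) u))

isOrbitRep? : (s : Gen) → ∀ {n} (j : ℕ) (u : Word n) → Dec (IsOrbitRep s j u)
isOrbitRep? s zero    u = (iter s 0 u ≟w u) ×-dec (0 ≟ℕ 1)
isOrbitRep? s (suc j) u =
  (iter s (suc j) u ≟w u)
  ×-dec all? (λ i → (iter s (suc (toℕ i)) u ≟w u) →-dec (suc (toℕ i) ≟ℕ suc j))
  ×-dec all? (λ i → value u ≤? value (iter s (toℕ i) u))

-- s^n_j : the number of orbits of size j of s acting on {0,1}^n
-- (counted via their lexicographically least representatives).
orbitCount : Gen → (n j : ℕ) → ℕ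
orbitCount s n j = length (filter (isOrbitRep? s j) (allWords n))

-- Splitting the words of length n+1 by their first letter gives four
-- recursions, one per generator and letter:
--   * a fixes every word 1w, and acts on 0w as b acts on w, so
--       a^{n+1}_1 = b^n_1 + 2^n   and   a^{n+1}_j = b^n_j  for j ≥ 2;
--   * b moves 1w down to 0w, so 1w never represents a b-orbit, while
--     b² acts on 0w as a acts on w, so
--       b^{n+1}_1 = 0             and   b^{n+1}_{2j} = a^n_j  for j ≥ 1.
-- Chaining the two middle recursions gives a^{2k+N}_{2^k} = a^N_1 and
-- b^{2k+N+1}_{2^{k+1}} = a^N_1, and a^N_1 is explicit: 1, 2, then 2^{N-1}.

module Submission where

open import Defs
open import Data.Nat using (ℕ; zero; suc; _+_; _*_; _∸_; _^_; _≤_; _<_; z≤n; s≤s)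
open import Data.Nat.Properties
open import Data.Product using (_×_; _,_; ∃-syntax)
open import Data.Bool using (Bool; true; false)
open import Data.Vec using ([]; _∷_)
open import Data.Vec.Properties using (∷-injectiveʳ)
open import Data.List using ([]; _∷_; _++_; length; filter; map)
open import Data.List.Properties using (length-++; length-map; filter-++; filter-≐; filter-all; filter-none)
open import Data.List.Relation.Unary.All using (universal)
open import Data.Fin as Fin using (toℕ; fromℕ<)
open import Data.Fin.Properties using (toℕ<n; toℕ-fromℕ<)
open import Function using (_∘_)
open import Data.Nat.Tactic.RingSolver using (solve-∀)
open import Relation.Nullary using (¬_; does)
open import Relation.Unary using (Decidable)
open import Relation.Binary.PropositionalEquality

module _ {A B : Set} {P : B → Set} (P? : Decidable P) (f : A → B) where

  count-map : ∀ xs → length (filter P? (map f xs)) ≡ length (filter (P? ∘ f) xs)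
  count-map [] = refl
  count-map (x ∷ xs) with does (P? (f x))
  ... | true  = cong suc (count-map xs)
  ... | false = count-map xs

length-allWords : ∀ n → length (allWords n) ≡ 2 ^ n
length-allWords zero    = refl
length-allWords (suc n) = begin
  length (map (false ∷_) ws ++ map (true ∷_) ws)
    ≡⟨ length-++ (map (false ∷_) ws) ⟩
  length (map (false ∷_) ws) + length (map (true ∷_) ws)
    ≡⟨ cong₂ _+_ (length-map (false ∷_) ws) (length-map (true ∷_) ws) ⟩
  length ws + length ws
    ≡⟨ cong₂ _+_ (length-allWords n) (length-allWords n) ⟩
  2 ^ n + 2 ^ n
    ≡⟨ cong (2 ^ n +_) (sym (+-identityʳ (2 ^ n))) ⟩
  2 ^ suc n ∎
  where
    open ≡-Reasoning
    ws = allWords n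

value<2^n : ∀ {n} (w : Word n) → value w < 2 ^ n
value<2^n []                = s≤s z≤n
value<2^n {suc n} (false ∷ w) = ≤-trans (value<2^n w) (m≤m+n (2 ^ n) (2 ^ n + 0))
value<2^n {suc n} (true  ∷ w) = +-monoʳ-< (2 ^ n) (≤-trans (value<2^n w) (m≤m+n (2 ^ n) 0))

record OrbitRep (s : Gen) {n} (j : ℕ) (u : Word n) : Set where
  field
    closes  : iter s (suc j) u ≡ u
    minimal : ∀ i → i < suc j → iter s (suc i) u ≡ u → i ≡ j
    least   : ∀ i → i < suc j → value u ≤ value (iter s i u)
open OrbitRep

module _ (s : Gen) {n} {j : ℕ} {u : Word n} where

  toOrbitRep : IsOrbitRep s (suc j) u → OrbitRep s j u
  toOrbitRep (c , m , l) = record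
    { closes  = c
    ; minimal = λ i i< → suc-injective ∘ subst (λ k → iter s (suc k) u ≡ u → suc k ≡ suc j)
                                                 (toℕ-fromℕ< i<) (m (fromℕ< i<))
    ; least   = λ i i< → subst (λ k → value u ≤ value (iter s k u)) (toℕ-fromℕ< i<) (l (fromℕ< i<))
    }

  fromOrbitRep : OrbitRep s j u → IsOrbitRep s (suc j) u
  fromOrbitRep r = closes r
                 , (λ i → cong suc ∘ minimal r (toℕ i) (toℕ<n i))
                 , (λ i → least r (toℕ i) (toℕ<n i))

module _ (s : Gen) {n} {u : Word n} (fixed : act s u ≡ u) where

  fixed-isRep : IsOrbitRep s 1 u
  fixed-isRep = fromOrbitRep s record
    { closes  = fixed
    ; minimal = λ { zero _ _ → refl ; (suc i) (s≤s ()) _ }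
    ; least   = λ { zero _ → ≤-refl ; (suc i) (s≤s ()) }
    }

  fixed-notRep : ∀ j → ¬ IsOrbitRep s (suc (suc j)) u
  fixed-notRep j r with minimal (toOrbitRep s r) 0 (s≤s z≤n) fixed
  ... | ()

descending-notRep : ∀ s {n} j {u : Word n} → value (act s u) < value u → ¬ IsOrbitRep s j u
descending-notRep s zero          _    (_ , ())
descending-notRep s (suc zero)    down (fixed , _) = <-irrefl (cong value fixed) down
descending-notRep s (suc (suc j)) down (_ , _ , least₁) = <⇒≱ down (least₁ (Fin.suc Fin.zero))

repsWith : Gen → ℕ → Bool → ℕ → ℕ
repsWith s j x n = length (filter (isOrbitRep? s j) (map (x ∷_) (allWords n)))

orbitCount-suc : ∀ s n j → orbitCount s (suc n) j ≡ repsWith s j false n + repsWith s j true n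
orbitCount-suc s n j =
  trans (cong length (filter-++ (isOrbitRep? s j) (map (false ∷_) ws) (map (true ∷_) ws)))
        (length-++ (filter (isOrbitRep? s j) (map (false ∷_) ws)))
  where ws = allWords n

module _ (s : Gen) (j : ℕ) (x : Bool) (n : ℕ) where

  repsWith-≐ : ∀ t i → (∀ {w} → IsOrbitRep s j (x ∷ w) → IsOrbitRep t i w)
                     → (∀ {w} → IsOrbitRep t i w → IsOrbitRep s j (x ∷ w))
                     → repsWith s j x n ≡ orbitCount t n i
  repsWith-≐ t i to from =
    trans (count-map (isOrbitRep? s j) (x ∷_) (allWords n))
          (cong length (filter-≐ _ (isOrbitRep? t i) (to , from) (allWords n)))

  repsWith-none : (∀ w → ¬ IsOrbitRep s j (x ∷ w)) → repsWith s j x n ≡ 0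
  repsWith-none none =
    trans (count-map (isOrbitRep? s j) (x ∷_) (allWords n))
          (cong length (filter-none _ (universal none (allWords n))))

  repsWith-all : (∀ w → IsOrbitRep s j (x ∷ w)) → repsWith s j x n ≡ 2 ^ n
  repsWith-all all =
    trans (count-map (isOrbitRep? s j) (x ∷_) (allWords n))
          (trans (cong length (filter-all _ (universal all (allWords n)))) (length-allWords n))

iterA-0 : ∀ {n} k (w : Word n) → iter genA k (false ∷ w) ≡ false ∷ iter genB k w
iterA-0 zero    w = refl
iterA-0 (suc k) w = cong basA (iterA-0 k w)

module _ {n} {j : ℕ} {w : Word n} where

  orbitRepA-0-to : OrbitRep genA j (false ∷ w) → OrbitRep genB j w
  orbitRepA-0-to r = record
    { closes  = ∷-injectiveʳ (trans (sym (iterA-0 (suc j) w)) (closes r))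
    ; minimal = λ i i< ret → minimal r i i< (trans (iterA-0 (suc i) w) (cong (false ∷_) ret))
    ; least   = λ i i< → subst (λ v → value w ≤ value v) (iterA-0 i w) (least r i i<)
    }

  orbitRepA-0-from : OrbitRep genB j w → OrbitRep genA j (false ∷ w)
  orbitRepA-0-from r = record
    { closes  = trans (iterA-0 (suc j) w) (cong (false ∷_) (closes r))
    ; minimal = λ i i< ret → minimal r i i< (∷-injectiveʳ (trans (sym (iterA-0 (suc i) w)) ret))
    ; least   = λ i i< → subst (λ v → value w ≤ value v) (sym (iterA-0 i w)) (least r i i<)
    }

repsA-0 : ∀ n j → repsWith genA (suc j) false n ≡ orbitCount genB n (suc j)
repsA-0 n j = repsWith-≐ genA (suc j) false n genB (suc j)
  (fromOrbitRep genB ∘ orbitRepA-0-to ∘ toOrbitRep genA)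
  (fromOrbitRep genA ∘ orbitRepA-0-from ∘ toOrbitRep genB)

iterB-0-even : ∀ {n} p (w : Word n) → iter genB (p * 2) (false ∷ w) ≡ false ∷ iter genA p w
iterB-0-odd  : ∀ {n} p (w : Word n) → iter genB (suc (p * 2)) (false ∷ w) ≡ true ∷ iter genA (suc p) w
iterB-0-even zero    w = refl
iterB-0-even (suc p) w = cong basB (iterB-0-odd p w)
iterB-0-odd  p       w = cong basB (iterB-0-even p w)

data EvenOdd : ℕ → Set where
  even : ∀ p → EvenOdd (p * 2)
  odd  : ∀ p → EvenOdd (suc (p * 2))

evenOdd : ∀ i → EvenOdd i
evenOdd zero = even 0
evenOdd (suc i) with evenOdd i
... | even p = odd p
... | odd  p = even (suc p)

double-< : ∀ {i j} → i < suc j → suc (i * 2) < suc j * 2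
double-< i< = s≤s (s≤s (*-monoˡ-≤ 2 (≤-pred i<)))

-- Hence 0w is least in a b-orbit of size 2(j+1) iff w is least in an
-- a-orbit of size j+1: b-orbits through 0w have twice the size, and the
-- odd iterates 1v are larger than every word starting with 0.
module _ {n} {j : ℕ} {w : Word n} where

  orbitRepB-0-to : OrbitRep genB (suc (j * 2)) (false ∷ w) → OrbitRep genA j w
  orbitRepB-0-to r = record
    { closes  = ∷-injectiveʳ (trans (sym (iterB-0-even (suc j) w)) (closes r))
    ; minimal = λ i i< ret → *-cancelʳ-≡ i j 2 (suc-injective
                  (minimal r (suc (i * 2)) (double-< i<)
                     (trans (iterB-0-even (suc i) w) (cong (false ∷_) ret))))
    ; least   = λ i i< → subst (λ v → value w ≤ value v) (iterB-0-even i w)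
                  (least r (i * 2) (<-trans (n<1+n (i * 2)) (double-< i<)))
    }

  orbitRepB-0-from : OrbitRep genA j w → OrbitRep genB (suc (j * 2)) (false ∷ w)
  orbitRepB-0-from r = record
    { closes  = trans (iterB-0-even (suc j) w) (cong (false ∷_) (closes r))
    ; minimal = minimal′
    ; least   = least′
    }
    where
    -- A return to 0w happens at an even time 2(p+1), so a returns to w at time p+1.
    minimal′ : ∀ i → i < suc (suc (j * 2)) → iter genB (suc i) (false ∷ w) ≡ false ∷ w → i ≡ suc (j * 2)
    minimal′ i i< ret with evenOdd i
    ... | even p with trans (sym (iterB-0-odd p w)) ret
    ...   | ()
    minimal′ _ i< ret | odd p =
      cong (λ q → suc (q * 2))
           (minimal r p (*-cancelʳ-≤ (suc p) (suc j) 2 i<)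
              (∷-injectiveʳ (trans (sym (iterB-0-even (suc p) w)) ret)))

    -- Even iterates are 0 followed by an a-iterate; odd ones start with 1.
    least′ : ∀ i → i < suc (suc (j * 2)) → value w ≤ value (iter genB i (false ∷ w))
    least′ i i< with evenOdd i
    ... | even p = subst (λ v → value w ≤ value v) (sym (iterB-0-even p w))
                     (least r p (*-cancelʳ-< 2 p (suc j) i<))
    ... | odd  p = subst (λ v → value w ≤ value v) (sym (iterB-0-odd p w))
                     (≤-trans (<⇒≤ (value<2^n w)) (m≤m+n (2 ^ n) _))

repsB-0 : ∀ n j → repsWith genB (suc j * 2) false n ≡ orbitCount genA n (suc j)
repsB-0 n j = repsWith-≐ genB (suc j * 2) false n genA (suc j)
  (fromOrbitRep genA ∘ orbitRepB-0-to ∘ toOrbitRep genB)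
  (fromOrbitRep genB ∘ orbitRepB-0-from ∘ toOrbitRep genA)

-- a^{n+1}_j = b^n_j for j ≥ 2: the words 1w are fixed by a.
countA-large : ∀ n j → 2 ≤ j → orbitCount genA (suc n) j ≡ orbitCount genB n j
countA-large n (suc (suc j)) _ = begin
  orbitCount genA (suc n) (suc (suc j))
    ≡⟨ orbitCount-suc genA n (suc (suc j)) ⟩
  repsWith genA (suc (suc j)) false n + repsWith genA (suc (suc j)) true n
    ≡⟨ cong₂ _+_ (repsA-0 n (suc j))
                 (repsWith-none genA (suc (suc j)) true n (λ w → fixed-notRep genA refl j)) ⟩
  orbitCount genB n (suc (suc j)) + 0
    ≡⟨ +-identityʳ _ ⟩
  orbitCount genB n (suc (suc j)) ∎
  where open ≡-Reasoning
countA-large n (suc zero) (s≤s ())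

-- a^{n+1}_1 = b^n_1 + 2^n: each of the 2^n words 1w is a fixed point of a.
countA-one : ∀ n → orbitCount genA (suc n) 1 ≡ orbitCount genB n 1 + 2 ^ n
countA-one n = trans (orbitCount-suc genA n 1)
  (cong₂ _+_ (repsA-0 n 0) (repsWith-all genA 1 true n (λ w → fixed-isRep genA refl)))

-- b^{n+1}_1 = 0: b changes the first letter, so it has no fixed points.
countB-one : ∀ n → orbitCount genB (suc n) 1 ≡ 0
countB-one n = trans (orbitCount-suc genB n 1)
  (cong₂ _+_ (repsWith-none genB 1 false n (λ { w (() , _) }))
             (repsWith-none genB 1 true n (λ { w (() , _) })))

-- b^{n+1}_{2j} = a^n_j for j ≥ 1: the words 1w are not least in their
-- b-orbits, since b(1w) = 0w.
countB-double : ∀ n j → 1 ≤ j → orbitCount genB (suc n) (2 * j) ≡ orbitCount genA n j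
countB-double n (suc j) _ = begin
  orbitCount genB (suc n) (2 * suc j)
    ≡⟨ cong (orbitCount genB (suc n)) (*-comm 2 (suc j)) ⟩
  orbitCount genB (suc n) (suc j * 2)
    ≡⟨ orbitCount-suc genB n (suc j * 2) ⟩
  repsWith genB (suc j * 2) false n + repsWith genB (suc j * 2) true n
    ≡⟨ cong₂ _+_ (repsB-0 n j) (repsWith-none genB (suc j * 2) true n 1w-notRep) ⟩
  orbitCount genA n (suc j) + 0
    ≡⟨ +-identityʳ _ ⟩
  orbitCount genA n (suc j) ∎
  where
  open ≡-Reasoning
  1w-notRep : ∀ w → ¬ IsOrbitRep genB (suc j * 2) (true ∷ w)
  1w-notRep w = descending-notRep genB (suc j * 2) (m<n+m (value w) (m^n>0 2 n))

fixedCountA : ∀ T → orbitCount genA (suc (suc T)) 1 ≡ 2 ^ suc T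
fixedCountA T = trans (countA-one (suc T)) (cong (_+ 2 ^ suc T) (countB-one T))

countB-pow : ∀ n k → orbitCount genB (suc n) (2 ^ suc k) ≡ orbitCount genA n (2 ^ k)
countB-pow n k = countB-double n (2 ^ k) (m^n>0 2 k)

countA-pow : ∀ n k → orbitCount genA (suc (suc n)) (2 ^ suc k) ≡ orbitCount genA n (2 ^ k)
countA-pow n k = trans (countA-large (suc n) (2 ^ suc k) (*-monoʳ-≤ 2 (m^n>0 2 k))) (countB-pow n k)

-- 2(k+1) + N = (2k + N) + 2, exposing the two letters peeled off by countA-pow.
two-more : ∀ k N → 2 * suc k + N ≡ suc (suc (2 * k + N))
two-more k N = cong (_+ N) (*-suc 2 k)

descentA : ∀ k N → orbitCount genA (2 * k + N) (2 ^ k) ≡ orbitCount genA N 1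
descentA zero    N = refl
descentA (suc k) N = begin
  orbitCount genA (2 * suc k + N) (2 ^ suc k)
    ≡⟨ cong (λ m → orbitCount genA m (2 ^ suc k)) (two-more k N) ⟩
  orbitCount genA (suc (suc (2 * k + N))) (2 ^ suc k)
    ≡⟨ countA-pow (2 * k + N) k ⟩
  orbitCount genA (2 * k + N) (2 ^ k)
    ≡⟨ descentA k N ⟩
  orbitCount genA N 1 ∎
  where open ≡-Reasoning

descentB : ∀ k N → orbitCount genB (2 * suc k + N) (2 ^ suc k) ≡ orbitCount genA (suc N) 1
descentB k N = begin
  orbitCount genB (2 * suc k + N) (2 ^ suc k)
    ≡⟨ cong (λ m → orbitCount genB m (2 ^ suc k)) (trans (two-more k N) (cong suc (sym (+-suc (2 * k) N)))) ⟩
  orbitCount genB (suc (2 * k + suc N)) (2 ^ suc k)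
    ≡⟨ countB-pow (2 * k + suc N) k ⟩
  orbitCount genA (2 * k + suc N) (2 ^ k)
    ≡⟨ descentA k (suc N) ⟩
  orbitCount genA (suc N) 1 ∎
  where open ≡-Reasoning

-- Writing n = 2m + e with m = k + 1 + d gives n = 2k + (2d + e + 2).
split-twice : ∀ k d e → 2 * suc (k + d) + e ≡ 2 * k + suc (suc (2 * d + e))
split-twice = solve-∀

below-middle : ∀ {n} m e k → n ≡ 2 * m + e → 1 ≤ k → k ≤ m ∸ 1 → ∃[ T ] n ≡ 2 * k + suc (suc T)
below-middle (suc m) e k refl (s≤s _) k≤ with m≤n⇒∃[o]m+o≡n k≤
... | d , refl = 2 * d + e , split-twice k d e

-- Sizes 2^k with 1 ≤ k ≤ m - 1, where n = 2m + e: here n = 2k + (T + 2),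
-- so a^n_{2^k} = a^{T+2}_1 = 2^{T+1} and b^n_{2^k} = a^{T+3}_1 = 2^{T+2}.
counts-below-middle : ∀ {n} m e → n ≡ 2 * m + e → ∀ k → 1 ≤ k → k ≤ m ∸ 1 →
    orbitCount genA n (2 ^ k) ≡ 2 ^ (n ∸ 2 * k ∸ 1)
  × orbitCount genB n (2 ^ k) ≡ 2 ^ (n ∸ 2 * k)
counts-below-middle m e n≡ k 1≤k k≤ with below-middle m e k n≡ 1≤k k≤
counts-below-middle _ _ _ (suc k) _ _ | T , refl rewrite m+n∸m≡n (2 * suc k) (suc (suc T)) =
    trans (descentA (suc k) (suc (suc T))) (fixedCountA T)
  , trans (descentB k (suc (suc T))) (fixedCountA (suc T))

-- The sizes 2^m and 2^{m+1} for odd n = 2m + 1 ≥ 4, via a^1_1 = 2, a^2_1 = 2, a^0_1 = 1.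
counts-odd-middle : ∀ {n} m → 4 ≤ n → n ≡ 2 * m + 1 →
    orbitCount genA n (2 ^ m) ≡ 2
  × orbitCount genB n (2 ^ m) ≡ 2
  × orbitCount genB n (2 ^ (m + 1)) ≡ 1
counts-odd-middle zero    (s≤s ()) refl
counts-odd-middle (suc m) _        refl =
    descentA (suc m) 1
  , trans (descentB m 1) (fixedCountA 0)
  , trans (cong₂ (orbitCount genB) (+-suc (2 * suc m) 0) (cong (2 ^_) (+-comm (suc m) 1)))
          (trans (countB-pow (2 * suc m + 0) (suc m)) (descentA (suc m) 0))

-- The size 2^m for even n = 2m ≥ 4, via a^0_1 = 1 and a^1_1 = 2.
counts-even-middle : ∀ {n} m → 4 ≤ n → n ≡ 2 * m →
    orbitCount genA n (2 ^ m) ≡ 1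
  × orbitCount genB n (2 ^ m) ≡ 2
counts-even-middle zero    ()  refl
counts-even-middle (suc m) _   refl =
    trans (cong (λ l → orbitCount genA l (2 ^ suc m)) (sym (+-identityʳ (2 * suc m))))
          (descentA (suc m) 0)
  , trans (cong (λ l → orbitCount genB l (2 ^ suc m)) (sym (+-identityʳ (2 * suc m))))
          (descentB m 0)

proposition2p4 :
    (n : ℕ) → 4 ≤ n →
      ((m : ℕ) → n ≡ 2 * m + 1 →
          ((k : ℕ) → 1 ≤ k → k ≤ m ∸ 1 →
              orbitCount genA n (2 ^ k) ≡ 2 ^ (n ∸ 2 * k ∸ 1)
            × orbitCount genB n (2 ^ k) ≡ 2 ^ (n ∸ 2 * k))
        × orbitCount genA n (2 ^ m) ≡ 2
        × orbitCount genB n (2 ^ m) ≡ 2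
        × orbitCount genB n (2 ^ (m + 1)) ≡ 1)
    × ((m : ℕ) → n ≡ 2 * m →
          ((k : ℕ) → 1 ≤ k → k ≤ m ∸ 1 →
              orbitCount genA n (2 ^ k) ≡ 2 ^ (n ∸ 2 * k ∸ 1)
            × orbitCount genB n (2 ^ k) ≡ 2 ^ (n ∸ 2 * k))
        × orbitCount genA n (2 ^ m) ≡ 1
        × orbitCount genB n (2 ^ m) ≡ 2)
proposition2p4 n 4≤n =
    (λ m n≡2m+1 → counts-below-middle m 1 n≡2m+1 , counts-odd-middle m 4≤n n≡2m+1)
  , (λ m n≡2m → counts-below-middle m 0 (trans n≡2m (sym (+-identityʳ (2 * m))))
              , counts-even-middle m 4≤n n≡2m)
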